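{- Let $G$ be a simple undirected graph on $N$ nodes with adjacency matrix $A$, and let $P_4$ be the $N\times N$ matrix whose $(i,j)$ entry is the number of paths of length $4$ from node $i$ to node $j$. Then $$\begin{aligned}P_4={}&A^4-\left(I\circ A^2\right)A^2-\left(I\circ A^3\right)A-I\circ A^4-A\left(I\circ A^2\right)A-A\left(I\circ A^3\right)-A^2\left(I\circ A^2\right)\\&+3\left(I\circ A^2\right)^2+3\,A\circ A^2+I\circ\left(A\left(I\circ A^2\right)A\right)+2A^2-3\left(I\circ A^2\right)-\left(I\circ A^2\right)^2+\left(I\circ A^2\right).\end{aligned}$$
   Context: $A$ is the symmetric $0$-$1$ matrix with $a_{ij}=1$ iff nodes $i$ and $j$ are linked, and $a_{ii}=0$. $I$ is the $N\times N$ identity matrix and $\circ$ denotes the Hadamard (entrywise) product. A walk of length $k$ from $i$ to $j$ is a sequence of nodes $n_0=i,n_1,\dots,n_k=j$ with consecutive nodes adjacent; a path of length $k$ is a walk of length $k$ in which all $k+1$ nodes $n_0,\dots,n_k$ are pairwise distinct. Paths are counted as ordered sequences from source $i$ to destination $j$. -}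

module Defs where

open import Data.Nat as ℕ using (ℕ; zero; suc)
open import Data.Integer as ℤ using (ℤ; +_)
open import Data.Fin using (Fin; zero; suc)
open import Data.Bool using (Bool; true; false; if_then_else_; _∧_; not)
open import Data.Fin using (_≟_)
open import Relation.Nullary.Decidable using (⌊_⌋)
open import Relation.Binary.PropositionalEquality using (_≡_)

sumℕ : ∀ {n} → (Fin n → ℕ) → ℕ
sumℕ {zero}  f = 0
sumℕ {suc n} f = f zero ℕ.+ sumℕ (λ i → f (suc i))

sumℤ : ∀ {n} → (Fin n → ℤ) → ℤ
sumℤ {zero}  f = + 0
sumℤ {suc n} f = f zero ℤ.+ sumℤ (λ i → f (suc i))

record SimpleGraph (N : ℕ) : Set where
  field
    adj   : Fin N → Fin N → Bool
    sym   : ∀ i j → adj i j ≡ adj j i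
    irrefl : ∀ i → adj i i ≡ false

Matrix : ℕ → Set
Matrix N = Fin N → Fin N → ℤ

module _ {N : ℕ} where

  _⊕_ : Matrix N → Matrix N → Matrix N
  (M ⊕ K) i j = M i j ℤ.+ K i j

  _⊖_ : Matrix N → Matrix N → Matrix N
  (M ⊖ K) i j = M i j ℤ.- K i j

  _⊗_ : Matrix N → Matrix N → Matrix N
  (M ⊗ K) i j = sumℤ (λ k → M i k ℤ.* K k j)

  _∘ₕ_ : Matrix N → Matrix N → Matrix N
  (M ∘ₕ K) i j = M i j ℤ.* K i j

  _·_ : ℤ → Matrix N → Matrix N
  (c · M) i j = c ℤ.* M i j

  idM : Matrix N
  idM i j = if ⌊ i ≟ j ⌋ then + 1 else + 0

  infixl 6 _⊕_ _⊖_
  infixl 7 _⊗_ _∘ₕ_ _·_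

adjMatrix : ∀ {N} → SimpleGraph N → Matrix N
adjMatrix G i j = if SimpleGraph.adj G i j then + 1 else + 0

_≢ᵇ_ : ∀ {N} → Fin N → Fin N → Bool
i ≢ᵇ j = not ⌊ i ≟ j ⌋

isPath4 : ∀ {N} → SimpleGraph N → Fin N → Fin N → Fin N → Fin N → Fin N → Bool
isPath4 G n0 n1 n2 n3 n4 =
  (a n0 n1 ∧ a n1 n2 ∧ a n2 n3 ∧ a n3 n4) ∧
  (n0 ≢ᵇ n1 ∧ n0 ≢ᵇ n2 ∧ n0 ≢ᵇ n3 ∧ n0 ≢ᵇ n4 ∧
   n1 ≢ᵇ n2 ∧ n1 ≢ᵇ n3 ∧ n1 ≢ᵇ n4 ∧
   n2 ≢ᵇ n3 ∧ n2 ≢ᵇ n4 ∧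
   n3 ≢ᵇ n4)
  where a = SimpleGraph.adj G

pathCount4 : ∀ {N} → SimpleGraph N → Fin N → Fin N → ℕ
pathCount4 G i j =
  sumℕ λ n1 → sumℕ λ n2 → sumℕ λ n3 →
    if isPath4 G i n1 n2 n3 j then 1 else 0

P4 : ∀ {N} → SimpleGraph N → Matrix N
P4 G i j = + pathCount4 G i j

module Submission where

-- Evaluated at (i, j), every term of the right-hand side is a sum over the walks
-- i → p → q → r → j of a product of Kronecker deltas forcing some nodes of the walk
-- to coincide: (I ∘ A²) A² sums over the walks with q = i, A ∘ A² over those with
-- r = i and q = j (and, A being symmetric and 0-1, over two other patterns), and so on.
-- So the right-hand side sums over all walks a weight that depends only on which of
-- their nodes coincide. As consecutive nodes of a walk differ, the coincidences form
-- one of only fifteen patterns, and the weight is 1 on the pattern without coincidence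
-- and 0 on the fourteen others: the formula counts the walks with five distinct nodes.

open import Defs

open import Data.Bool using (Bool; true; false; T; not; _∧_; if_then_else_)
open import Data.Bool.Properties using (T?; T-∧)
open import Data.Fin using (Fin; zero; suc; _≟_)
open import Data.Integer as ℤ using (ℤ; +_; _+_; _-_; _*_; -_; -1ℤ)
open import Data.Integer.Properties
  using ( +-*-semiring; *-commutativeSemigroup; +-identityˡ; +-identityʳ
        ; *-identityˡ; *-identityʳ; *-zeroʳ; *-assoc; *-distribˡ-+; -1*i≡-i; pos-+ )
open import Data.Integer.Tactic.RingSolver using (solve-∀)
open import Data.Nat using (ℕ; zero; suc)
open import Data.Product using (_×_; _,_; map₂)
open import Function using (_∘_; Equivalence)
open import Relation.Binary.PropositionalEquality
  using (_≡_; _≢_; refl; sym; trans; cong; cong₂; subst; module ≡-Reasoning)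
open import Relation.Nullary.Decidable
  using (Dec; yes; no; ⌊_⌋; toWitness; fromWitness; fromWitnessFalse; map′; _×-dec_; _→-dec_; from-yes)

open import Algebra.Properties.Semiring.Sum +-*-semiring
  using (sum; sum-cong-≗; sum-replicate-zero; ∑-distrib-+; ∑-comm; *-distribˡ-sum; *-distribʳ-sum)
open import Algebra.Properties.CommutativeSemigroup *-commutativeSemigroup
  using (x∙yz≈y∙xz; x∙yz≈z∙xy; x∙yz≈z∙yx; x∙yz≈xz∙y; xy∙z≈yz∙x)

open ≡-Reasoning

χ : Bool → ℤ
χ b = if b then + 1 else + 0

χ-∧ : ∀ a b → χ (a ∧ b) ≡ χ a * χ b
χ-∧ false b = refl
χ-∧ true  b = sym (*-identityˡ (χ b))

χ-guarded : ∀ a b {x} → (T a → χ b ≡ x) → χ (a ∧ b) ≡ χ a * x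
χ-guarded false b h = refl
χ-guarded true  b {x} h = trans (h _) (sym (*-identityˡ x))

T-∧⁴ : ∀ {a b c d} → T (a ∧ b ∧ c ∧ d) → T a × T b × T c × T d
T-∧⁴ t = map₂ (map₂ (Equivalence.to T-∧) ∘ Equivalence.to T-∧) (Equivalence.to T-∧ t)

pos-if : ∀ b → + (if b then 1 else 0) ≡ χ b
pos-if false = refl
pos-if true  = refl

sumℤ≡sum : ∀ {n} (f : Fin n → ℤ) → sumℤ f ≡ sum f
sumℤ≡sum {zero}  f = refl
sumℤ≡sum {suc n} f = cong (_+_ (f zero)) (sumℤ≡sum (f ∘ suc))

sumℤ-cong : ∀ {n} {f g : Fin n → ℤ} → (∀ k → f k ≡ g k) → sumℤ f ≡ sumℤ g
sumℤ-cong {f = f} {g} f≗g = begin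
  sumℤ f  ≡⟨ sumℤ≡sum f ⟩
  sum f   ≡⟨ sum-cong-≗ f≗g ⟩
  sum g   ≡⟨ sumℤ≡sum g ⟨
  sumℤ g  ∎

sumℤ-zero : ∀ n → sumℤ {n} (λ _ → + 0) ≡ + 0
sumℤ-zero n = trans (sumℤ≡sum {n} (λ _ → + 0)) (sum-replicate-zero n)

sumℤ-distrib-+ : ∀ {n} (f g : Fin n → ℤ) → sumℤ (λ k → f k + g k) ≡ sumℤ f + sumℤ g
sumℤ-distrib-+ f g = begin
  sumℤ (λ k → f k + g k)  ≡⟨ sumℤ≡sum (λ k → f k + g k) ⟩
  sum (λ k → f k + g k)   ≡⟨ ∑-distrib-+ f g ⟩
  sum f + sum g           ≡⟨ cong₂ _+_ (sumℤ≡sum f) (sumℤ≡sum g) ⟨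
  sumℤ f + sumℤ g         ∎

*-distribˡ-sumℤ : ∀ {n} c (f : Fin n → ℤ) → c * sumℤ f ≡ sumℤ (λ k → c * f k)
*-distribˡ-sumℤ c f = begin
  c * sumℤ f              ≡⟨ cong (c *_) (sumℤ≡sum f) ⟩
  c * sum f               ≡⟨ *-distribˡ-sum c f ⟩
  sum (λ k → c * f k)     ≡⟨ sumℤ≡sum (λ k → c * f k) ⟨
  sumℤ (λ k → c * f k)    ∎

*-distribʳ-sumℤ : ∀ {n} c (f : Fin n → ℤ) → sumℤ f * c ≡ sumℤ (λ k → f k * c)
*-distribʳ-sumℤ c f = begin
  sumℤ f * c              ≡⟨ cong (_* c) (sumℤ≡sum f) ⟩
  sum f * c               ≡⟨ *-distribʳ-sum c f ⟩
  sum (λ k → f k * c)     ≡⟨ sumℤ≡sum (λ k → f k * c) ⟨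
  sumℤ (λ k → f k * c)    ∎

sumℤ-comm : ∀ {m n} (f : Fin m → Fin n → ℤ) →
            sumℤ (λ k → sumℤ (f k)) ≡ sumℤ (λ l → sumℤ (λ k → f k l))
sumℤ-comm f = begin
  sumℤ (λ k → sumℤ (f k))           ≡⟨ nested f ⟩
  sum (λ k → sum (f k))             ≡⟨ ∑-comm f ⟩
  sum (λ l → sum (λ k → f k l))     ≡⟨ nested (λ l k → f k l) ⟨
  sumℤ (λ l → sumℤ (λ k → f k l))   ∎
  where
  nested : ∀ {m n} (g : Fin m → Fin n → ℤ) → sumℤ (λ k → sumℤ (g k)) ≡ sum (λ k → sum (g k))
  nested g = trans (sumℤ≡sum (λ k → sumℤ (g k))) (sum-cong-≗ (λ k → sumℤ≡sum (g k)))

idM-suc : ∀ {n} (x y : Fin n) → idM (suc x) (suc y) ≡ idM x y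
idM-suc x y with x ≟ y
... | yes _ = refl
... | no  _ = refl

idM-sym : ∀ {n} (x y : Fin n) → idM x y ≡ idM y x
idM-sym zero    zero    = refl
idM-sym zero    (suc y) = refl
idM-sym (suc x) zero    = refl
idM-sym (suc x) (suc y) = trans (idM-suc x y) (trans (idM-sym x y) (sym (idM-suc y x)))

sumℤ-idM : ∀ {n} (f : Fin n → ℤ) x → sumℤ (λ k → f k * idM k x) ≡ f x
sumℤ-idM {suc n} f zero = begin
  f zero * + 1 + sumℤ (λ k → f (suc k) * + 0)  ≡⟨ cong₂ _+_ (*-identityʳ (f zero)) zeros ⟩
  f zero + + 0                                 ≡⟨ +-identityʳ (f zero) ⟩
  f zero                                       ∎
  where
  zeros : sumℤ (λ k → f (suc k) * + 0) ≡ + 0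
  zeros = trans (sumℤ-cong (λ k → *-zeroʳ (f (suc k)))) (sumℤ-zero n)
sumℤ-idM {suc n} f (suc x) = begin
  f zero * + 0 + sumℤ (λ k → f (suc k) * idM (suc k) (suc x))
    ≡⟨ cong₂ _+_ (*-zeroʳ (f zero)) (sumℤ-cong (λ k → cong (f (suc k) *_) (idM-suc k x))) ⟩
  + 0 + sumℤ (λ k → f (suc k) * idM k x)
    ≡⟨ +-identityˡ (sumℤ (λ k → f (suc k) * idM k x)) ⟩
  sumℤ (λ k → f (suc k) * idM k x)
    ≡⟨ sumℤ-idM (f ∘ suc) x ⟩
  f (suc x) ∎

pos-sumℕ : ∀ {n} (f : Fin n → ℕ) → + sumℕ f ≡ sumℤ (λ k → + f k)
pos-sumℕ {zero}  f = refl
pos-sumℕ {suc n} f = trans (pos-+ (f zero) (sumℕ (f ∘ suc))) (cong (_+_ (+ f zero)) (pos-sumℕ (f ∘ suc)))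

sumℤ-product : ∀ {n} (f g : Fin n → ℤ) → sumℤ f * sumℤ g ≡ sumℤ (λ k → sumℤ (λ l → f k * g l))
sumℤ-product f g = trans (*-distribʳ-sumℤ (sumℤ g) f) (sumℤ-cong (λ k → *-distribˡ-sumℤ (f k) g))

Σ² : ∀ {n} → (Fin n → Fin n → ℤ) → ℤ
Σ² F = sumℤ λ k → sumℤ (F k)

Σ³ : ∀ {n} → (Fin n → Fin n → Fin n → ℤ) → ℤ
Σ³ F = sumℤ λ k → Σ² (F k)

module _ {n : ℕ} where

  Σ²-cong : {F G : Fin n → Fin n → ℤ} → (∀ k l → F k l ≡ G k l) → Σ² F ≡ Σ² G
  Σ²-cong F≗G = sumℤ-cong (λ k → sumℤ-cong (F≗G k))

  Σ³-cong : {F G : Fin n → Fin n → Fin n → ℤ} → (∀ k l m → F k l m ≡ G k l m) → Σ³ F ≡ Σ³ G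
  Σ³-cong F≗G = sumℤ-cong (λ k → Σ²-cong (F≗G k))

  *-distribˡ-Σ² : ∀ c (F : Fin n → Fin n → ℤ) → c * Σ² F ≡ Σ² (λ k l → c * F k l)
  *-distribˡ-Σ² c F = trans (*-distribˡ-sumℤ c (λ k → sumℤ (F k))) (sumℤ-cong (λ k → *-distribˡ-sumℤ c (F k)))

  *-distribʳ-Σ² : ∀ c (F : Fin n → Fin n → ℤ) → Σ² F * c ≡ Σ² (λ k l → F k l * c)
  *-distribʳ-Σ² c F = trans (*-distribʳ-sumℤ c (λ k → sumℤ (F k))) (sumℤ-cong (λ k → *-distribʳ-sumℤ c (F k)))

  *-distribˡ-Σ³ : ∀ c (F : Fin n → Fin n → Fin n → ℤ) → c * Σ³ F ≡ Σ³ (λ k l m → c * F k l m)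
  *-distribˡ-Σ³ c F = trans (*-distribˡ-sumℤ c (λ k → Σ² (F k))) (sumℤ-cong (λ k → *-distribˡ-Σ² c (F k)))

  Σ³-distrib-+ : ∀ (F G : Fin n → Fin n → Fin n → ℤ) →
                 Σ³ (λ k l m → F k l m + G k l m) ≡ Σ³ F + Σ³ G
  Σ³-distrib-+ F G =
    trans (sumℤ-cong λ k → trans (sumℤ-cong λ l → sumℤ-distrib-+ (F k l) (G k l))
                                 (sumℤ-distrib-+ (λ l → sumℤ (F k l)) (λ l → sumℤ (G k l))))
          (sumℤ-distrib-+ (λ k → Σ² (F k)) (λ k → Σ² (G k)))

  Σ³-rotate : ∀ (F : Fin n → Fin n → Fin n → ℤ) →
              sumℤ (λ m → Σ² (λ k l → F k l m)) ≡ Σ³ F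
  Σ³-rotate F = trans (sumℤ-comm (λ m k → sumℤ (λ l → F k l m)))
                      (sumℤ-cong (λ k → sumℤ-comm (λ m l → F k l m)))

  Σ²-sift-outer : ∀ (F : Fin n → Fin n → ℤ) x → Σ² (λ k l → F k l * idM k x) ≡ sumℤ (F x)
  Σ²-sift-outer F x = begin
    Σ² (λ k l → F k l * idM k x)        ≡⟨ sumℤ-cong (λ k → *-distribʳ-sumℤ (idM k x) (F k)) ⟨
    sumℤ (λ k → sumℤ (F k) * idM k x)   ≡⟨ sumℤ-idM (λ k → sumℤ (F k)) x ⟩
    sumℤ (F x)                          ∎

  Σ²-sift-inner : ∀ (F : Fin n → Fin n → ℤ) (g : Fin n → Fin n) →
                  Σ² (λ k l → F k l * idM l (g k)) ≡ sumℤ (λ k → F k (g k))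
  Σ²-sift-inner F g = sumℤ-cong (λ k → sumℤ-idM (F k) (g k))

  Σ³-sift₁ : ∀ (F : Fin n → Fin n → Fin n → ℤ) x → Σ³ (λ k l m → F k l m * idM k x) ≡ Σ² (F x)
  Σ³-sift₁ F x = begin
    Σ³ (λ k l m → F k l m * idM k x)          ≡⟨ Σ²-cong (λ k l → *-distribʳ-sumℤ (idM k x) (F k l)) ⟨
    Σ² (λ k l → sumℤ (F k l) * idM k x)       ≡⟨ Σ²-sift-outer (λ k l → sumℤ (F k l)) x ⟩
    Σ² (F x)                                  ∎

  Σ³-sift₂ : ∀ (F : Fin n → Fin n → Fin n → ℤ) x → Σ³ (λ k l m → F k l m * idM l x) ≡ Σ² (λ k m → F k x m)
  Σ³-sift₂ F x = sumℤ-cong (λ k → Σ²-sift-outer (F k) x)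

  Σ³-sift₃ : ∀ (F : Fin n → Fin n → Fin n → ℤ) (g : Fin n → Fin n → Fin n) →
             Σ³ (λ k l m → F k l m * idM m (g k l)) ≡ Σ² (λ k l → F k l (g k l))
  Σ³-sift₃ F g = sumℤ-cong (λ k → Σ²-sift-inner (F k) (g k))

*-assoc₄ : ∀ a b c d → a * (b * c) * d ≡ a * (b * (c * d))
*-assoc₄ a b c d = trans (*-assoc a (b * c) d) (cong (a *_) (*-assoc b c d))

module _ {n : ℕ} where

  diag-⊗ˡ : ∀ (K M : Matrix n) x y → ((idM ∘ₕ K) ⊗ M) x y ≡ K x x * M x y
  diag-⊗ˡ K M x y = begin
    sumℤ (λ k → idM x k * K x k * M k y)  ≡⟨ sumℤ-cong (λ k → trans (xy∙z≈yz∙x (idM x k) (K x k) (M k y))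
                                                              (cong (K x k * M k y *_) (idM-sym x k))) ⟩
    sumℤ (λ k → K x k * M k y * idM k x)  ≡⟨ sumℤ-idM (λ k → K x k * M k y) x ⟩
    K x x * M x y                         ∎

  diag-⊗ʳ : ∀ (M K : Matrix n) x y → (M ⊗ (idM ∘ₕ K)) x y ≡ M x y * K y y
  diag-⊗ʳ M K x y = begin
    sumℤ (λ k → M x k * (idM k y * K k y))  ≡⟨ sumℤ-cong (λ k → x∙yz≈xz∙y (M x k) (idM k y) (K k y)) ⟩
    sumℤ (λ k → M x k * K k y * idM k y)    ≡⟨ sumℤ-idM (λ k → M x k * K k y) y ⟩
    M x y * K y y                           ∎

  diag-⊗-diag : ∀ (K L : Matrix n) x y → ((idM ∘ₕ K) ⊗ (idM ∘ₕ L)) x y ≡ idM x y * ((idM ∘ₕ K) ⊗ L) x y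
  diag-⊗-diag K L x y = begin
    ((idM ∘ₕ K) ⊗ (idM ∘ₕ L)) x y  ≡⟨ diag-⊗ˡ K (idM ∘ₕ L) x y ⟩
    K x x * (idM x y * L x y)      ≡⟨ x∙yz≈y∙xz (K x x) (idM x y) (L x y) ⟩
    idM x y * (K x x * L x y)      ≡⟨ cong (idM x y *_) (diag-⊗ˡ K L x y) ⟨
    idM x y * ((idM ∘ₕ K) ⊗ L) x y ∎

  ⊗³-expand : ∀ (M K L : Matrix n) x y → ((M ⊗ K) ⊗ L) x y ≡ Σ² (λ p q → M x p * (K p q * L q y))
  ⊗³-expand M K L x y = begin
    sumℤ (λ q → sumℤ (λ p → M x p * K p q) * L q y)
      ≡⟨ sumℤ-cong (λ q → *-distribʳ-sumℤ (L q y) (λ p → M x p * K p q)) ⟩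
    sumℤ (λ q → sumℤ (λ p → M x p * K p q * L q y))
      ≡⟨ sumℤ-comm (λ q p → M x p * K p q * L q y) ⟩
    Σ² (λ p q → M x p * K p q * L q y)
      ≡⟨ Σ²-cong (λ p q → *-assoc (M x p) (K p q) (L q y)) ⟩
    Σ² (λ p q → M x p * (K p q * L q y)) ∎

  ⊗⁴-expand : ∀ (M K L P : Matrix n) x y →
              (((M ⊗ K) ⊗ L) ⊗ P) x y ≡ Σ³ (λ p q r → M x p * (K p q * (L q r * P r y)))
  ⊗⁴-expand M K L P x y = begin
    sumℤ (λ r → ((M ⊗ K) ⊗ L) x r * P r y)
      ≡⟨ sumℤ-cong (λ r → cong (_* P r y) (⊗³-expand M K L x r)) ⟩
    sumℤ (λ r → Σ² (λ p q → M x p * (K p q * L q r)) * P r y)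
      ≡⟨ sumℤ-cong (λ r → *-distribʳ-Σ² (P r y) (λ p q → M x p * (K p q * L q r))) ⟩
    sumℤ (λ r → Σ² (λ p q → M x p * (K p q * L q r) * P r y))
      ≡⟨ Σ³-rotate (λ p q r → M x p * (K p q * L q r) * P r y) ⟩
    Σ³ (λ p q r → M x p * (K p q * L q r) * P r y)
      ≡⟨ Σ³-cong (λ p q r → *-assoc₄ (M x p) (K p q) (L q r) (P r y)) ⟩
    Σ³ (λ p q r → M x p * (K p q * (L q r * P r y))) ∎

-- The weight of a walk i p q r j on the right-hand side, term by term;
-- qi stands for δ(q, i), and so on.
formulaWeight : (qi ri ij rp pj qj : ℤ) → ℤ
formulaWeight qi ri ij rp pj qj =
  + 1 - qi - ri - ij - rp - pj - qj
  + (+ 3) * (ij * qi) + (qj * ri + pj * ri + pj * qi) + ij * rp + (qi * rp + qj * rp)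
  - (+ 3) * (ij * (qi * rp)) - ij * qi + ij * (qi * rp)

infix 4 _&_⇒_ _&_⇒?_

_&_⇒_ : Bool → Bool → Bool → Set
a & b ⇒ c = T a → T b → T c

_&_⇒?_ : ∀ a b c → Dec (a & b ⇒ c)
a & b ⇒? c = T? a →-dec T? b →-dec T? c

-- ip, iq, …, rj say which pairs of nodes of a walk i p q r j coincide: consecutive nodes
-- differ, and coincidence is transitive (the instances needed below).
WalkPattern : (ip iq ir ij pq pr pj qr qj rj : Bool) → Set
WalkPattern ip iq ir ij pq pr pj qr qj rj =
    T (not ip) × T (not pq) × T (not qr) × T (not rj)
  × (iq & ir ⇒ qr) × (ir & ij ⇒ rj) × (ir & pr ⇒ ip) × (ij & pj ⇒ ip) × (pr & pj ⇒ rj)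
  × (pj & qj ⇒ pq) × (iq & ij ⇒ qj) × (iq & qj ⇒ ij) × (ij & qj ⇒ iq)

walkPattern? : ∀ ip iq ir ij pq pr pj qr qj rj → Dec (WalkPattern ip iq ir ij pq pr pj qr qj rj)
walkPattern? ip iq ir ij pq pr pj qr qj rj =
      T? (not ip) ×-dec T? (not pq) ×-dec T? (not qr) ×-dec T? (not rj)
  ×-dec (iq & ir ⇒? qr) ×-dec (ir & ij ⇒? rj) ×-dec (ir & pr ⇒? ip) ×-dec (ij & pj ⇒? ip)
  ×-dec (pr & pj ⇒? rj) ×-dec (pj & qj ⇒? pq) ×-dec (iq & ij ⇒? qj) ×-dec (iq & qj ⇒? ij)
  ×-dec (ij & qj ⇒? iq)

DistinctnessWeight : (ip iq ir ij pq pr pj qr qj rj : Bool) → Set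
DistinctnessWeight ip iq ir ij pq pr pj qr qj rj =
  WalkPattern ip iq ir ij pq pr pj qr qj rj →
  χ (not ip ∧ not iq ∧ not ir ∧ not ij ∧ not pq ∧ not pr ∧ not pj ∧ not qr ∧ not qj ∧ not rj)
    ≡ formulaWeight (χ iq) (χ ir) (χ ij) (χ pr) (χ pj) (χ qj)

∀-Bool? : {P : Bool → Set} → (∀ b → Dec (P b)) → Dec (∀ b → P b)
∀-Bool? P? = map′ (λ (f , t) → λ { false → f ; true → t }) (λ h → h false , h true) (P? false ×-dec P? true)

distinctnessWeight? : ∀ ip iq ir ij pq pr pj qr qj rj → Dec (DistinctnessWeight ip iq ir ij pq pr pj qr qj rj)
distinctnessWeight? ip iq ir ij pq pr pj qr qj rj = walkPattern? ip iq ir ij pq pr pj qr qj rj →-dec (_ ℤ.≟ _)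

distinctnessWeight : ∀ ip iq ir ij pq pr pj qr qj rj → DistinctnessWeight ip iq ir ij pq pr pj qr qj rj
distinctnessWeight = from-yes
  (∀-Bool? λ ip → ∀-Bool? λ iq → ∀-Bool? λ ir → ∀-Bool? λ ij → ∀-Bool? λ pq →
   ∀-Bool? λ pr → ∀-Bool? λ pj → ∀-Bool? λ qr → ∀-Bool? λ qj → ∀-Bool? λ rj →
   distinctnessWeight? ip iq ir ij pq pr pj qr qj rj)

module _ {N : ℕ} (G : SimpleGraph N) where
  open SimpleGraph G using (adj; irrefl)
  private A = adjMatrix G

  adjMatrix-sym : ∀ x y → A x y ≡ A y x
  adjMatrix-sym x y = cong χ (SimpleGraph.sym G x y)

  adjMatrix-idem : ∀ x y → A x y * A x y ≡ A x y
  adjMatrix-idem x y with adj x y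
  ... | true  = refl
  ... | false = refl

  adjMatrix-absorb : ∀ x y z → A x y * (A x y * z) ≡ A x y * z
  adjMatrix-absorb x y z = trans (sym (*-assoc (A x y) (A x y) z)) (cong (_* z) (adjMatrix-idem x y))

  adj⇒≢ : ∀ {x y} → T (adj x y) → x ≢ y
  adj⇒≢ {x} xy refl = subst T (irrefl x) xy

module Walks {N : ℕ} (G : SimpleGraph N) (i j : Fin N) where
  open SimpleGraph G using (adj)

  A A² A³ A⁴ D₂ D₃ : Matrix N
  A  = adjMatrix G
  A² = A ⊗ A
  A³ = A² ⊗ A
  A⁴ = A³ ⊗ A
  D₂ = idM ∘ₕ A²
  D₃ = idM ∘ₕ A³

  walk : Fin N → Fin N → Fin N → ℤ
  walk p q r = A i p * (A p q * (A q r * A r j))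

  walkSum : (Fin N → Fin N → Fin N → ℤ) → ℤ
  walkSum c = Σ³ λ p q r → walk p q r * c p q r

  walkSum-cong : ∀ {c d} → (∀ p q r → c p q r ≡ d p q r) → walkSum c ≡ walkSum d
  walkSum-cong c≗d = Σ³-cong (λ p q r → cong (walk p q r *_) (c≗d p q r))

  infixl 6 _⟨+⟩_ _⟨-⟩_
  infixr 7 _⟨*⟩_

  _⟨+⟩_ : ∀ {c d x y} → walkSum c ≡ x → walkSum d ≡ y →
          walkSum (λ p q r → c p q r + d p q r) ≡ x + y
  _⟨+⟩_ {c} {d} {x} {y} c≡x d≡y = begin
    walkSum (λ p q r → c p q r + d p q r)
      ≡⟨ Σ³-cong (λ p q r → *-distribˡ-+ (walk p q r) (c p q r) (d p q r)) ⟩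
    Σ³ (λ p q r → walk p q r * c p q r + walk p q r * d p q r)
      ≡⟨ Σ³-distrib-+ (λ p q r → walk p q r * c p q r) (λ p q r → walk p q r * d p q r) ⟩
    walkSum c + walkSum d
      ≡⟨ cong₂ _+_ c≡x d≡y ⟩
    x + y ∎

  _⟨*⟩_ : ∀ k {c x} → walkSum c ≡ x → walkSum (λ p q r → k * c p q r) ≡ k * x
  _⟨*⟩_ k {c} {x} c≡x = begin
    walkSum (λ p q r → k * c p q r)
      ≡⟨ Σ³-cong (λ p q r → x∙yz≈y∙xz (walk p q r) k (c p q r)) ⟩
    Σ³ (λ p q r → k * (walk p q r * c p q r))
      ≡⟨ *-distribˡ-Σ³ k (λ p q r → walk p q r * c p q r) ⟨
    k * walkSum c
      ≡⟨ cong (k *_) c≡x ⟩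
    k * x ∎

  _⟨-⟩_ : ∀ {c d x y} → walkSum c ≡ x → walkSum d ≡ y →
          walkSum (λ p q r → c p q r - d p q r) ≡ x - y
  _⟨-⟩_ {d = d} {y = y} c≡x d≡y = c≡x ⟨+⟩ negated
    where
    negated : walkSum (λ p q r → - d p q r) ≡ - y
    negated = trans (walkSum-cong (λ p q r → sym (-1*i≡-i (d p q r))))
                    (trans (-1ℤ ⟨*⟩ d≡y) (-1*i≡-i y))

  twice : ∀ {c d x} → walkSum c ≡ x → walkSum d ≡ x →
          walkSum (λ p q r → c p q r + d p q r) ≡ (+ 2) * x
  twice {x = x} c≡x d≡x = trans (c≡x ⟨+⟩ d≡x) (x+x≡2x x)
    where
    x+x≡2x : ∀ x → x + x ≡ (+ 2) * x
    x+x≡2x = solve-∀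

  thrice : ∀ {c d e x} → walkSum c ≡ x → walkSum d ≡ x → walkSum e ≡ x →
           walkSum (λ p q r → c p q r + d p q r + e p q r) ≡ (+ 3) * x
  thrice {x = x} c≡x d≡x e≡x = trans (c≡x ⟨+⟩ d≡x ⟨+⟩ e≡x) (x+x+x≡3x x)
    where
    x+x+x≡3x : ∀ x → x + x + x ≡ (+ 3) * x
    x+x+x≡3x = solve-∀

  walks-q=x : ∀ x → walkSum (λ _ q _ → idM q x) ≡ A² i x * A² x j
  walks-q=x x = begin
    walkSum (λ _ q _ → idM q x)                      ≡⟨ Σ³-sift₂ walk x ⟩
    Σ² (λ p r → walk p x r)                          ≡⟨ Σ²-cong (λ p r → *-assoc (A i p) (A p x) (A x r * A r j)) ⟨
    Σ² (λ p r → A i p * A p x * (A x r * A r j))     ≡⟨ sumℤ-product (λ p → A i p * A p x) (λ r → A x r * A r j) ⟨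
    A² i x * A² x j                                  ∎

  walks : walkSum (λ _ _ _ → + 1) ≡ A⁴ i j
  walks = trans (Σ³-cong (λ p q r → *-identityʳ (walk p q r))) (sym (⊗⁴-expand A A A A i j))

  walks-q=i : walkSum (λ _ q _ → idM q i) ≡ (D₂ ⊗ A²) i j
  walks-q=i = trans (walks-q=x i) (sym (diag-⊗ˡ A² A² i j))

  walks-q=j : walkSum (λ _ q _ → idM q j) ≡ (A² ⊗ D₂) i j
  walks-q=j = trans (walks-q=x j) (sym (diag-⊗ʳ A² A² i j))

  walks-r=i : walkSum (λ _ _ r → idM r i) ≡ (D₃ ⊗ A) i j
  walks-r=i = begin
    walkSum (λ _ _ r → idM r i)                      ≡⟨ Σ³-sift₃ walk (λ _ _ → i) ⟩
    Σ² (λ p q → walk p q i)                          ≡⟨ Σ²-cong (λ p q → *-assoc₄ (A i p) (A p q) (A q i) (A i j)) ⟨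
    Σ² (λ p q → A i p * (A p q * A q i) * A i j)     ≡⟨ *-distribʳ-Σ² (A i j) (λ p q → A i p * (A p q * A q i)) ⟨
    Σ² (λ p q → A i p * (A p q * A q i)) * A i j     ≡⟨ cong (_* A i j) (⊗³-expand A A A i i) ⟨
    A³ i i * A i j                                   ≡⟨ diag-⊗ˡ A³ A i j ⟨
    (D₃ ⊗ A) i j                                     ∎

  walks-r=p : walkSum (λ p _ r → idM r p) ≡ (A ⊗ D₂ ⊗ A) i j
  walks-r=p = begin
    walkSum (λ p _ r → idM r p)                      ≡⟨ Σ³-sift₃ walk (λ p _ → p) ⟩
    Σ² (λ p q → walk p q p)                          ≡⟨ Σ²-cong (λ p q → *-assoc₄ (A i p) (A p q) (A q p) (A p j)) ⟨
    Σ² (λ p q → A i p * (A p q * A q p) * A p j)     ≡⟨ sumℤ-cong (λ p → closedWalks p) ⟨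
    sumℤ (λ p → A i p * A² p p * A p j)              ≡⟨ sumℤ-cong (λ p → cong (_* A p j) (diag-⊗ʳ A A² i p)) ⟨
    (A ⊗ D₂ ⊗ A) i j                                 ∎
    where
    closedWalks : ∀ p → A i p * A² p p * A p j ≡ sumℤ (λ q → A i p * (A p q * A q p) * A p j)
    closedWalks p = trans (cong (_* A p j) (*-distribˡ-sumℤ (A i p) (λ q → A p q * A q p)))
                          (*-distribʳ-sumℤ (A p j) (λ q → A i p * (A p q * A q p)))

  walks-p=j : walkSum (λ p _ _ → idM p j) ≡ (A ⊗ D₃) i j
  walks-p=j = begin
    walkSum (λ p _ _ → idM p j)                      ≡⟨ Σ³-sift₁ walk j ⟩
    Σ² (λ q r → walk j q r)                          ≡⟨ *-distribˡ-Σ² (A i j) (λ q r → A j q * (A q r * A r j)) ⟨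
    A i j * Σ² (λ q r → A j q * (A q r * A r j))     ≡⟨ cong (A i j *_) (⊗³-expand A A A j j) ⟨
    A i j * A³ j j                                   ≡⟨ diag-⊗ʳ A A³ i j ⟨
    (A ⊗ D₃) i j                                     ∎

  walks-i=j : walkSum (λ _ _ _ → idM i j) ≡ (idM ∘ₕ A⁴) i j
  walks-i=j = trans (walkSum-cong (λ _ _ _ → sym (*-identityʳ (idM i j)))) (idM i j ⟨*⟩ walks)

  walks-q=i=j : walkSum (λ _ q _ → idM i j * idM q i) ≡ (D₂ ⊗ D₂) i j
  walks-q=i=j = trans (idM i j ⟨*⟩ walks-q=i) (sym (diag-⊗-diag A² A² i j))

  walk-p-j-i : ∀ p → walk p j i ≡ A i j * (A i p * A p j)
  walk-p-j-i p = begin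
    A i p * (A p j * (A j i * A i j))  ≡⟨ cong (λ t → A i p * (A p j * (t * A i j))) (adjMatrix-sym G j i) ⟩
    A i p * (A p j * (A i j * A i j))  ≡⟨ cong (λ t → A i p * (A p j * t)) (adjMatrix-idem G i j) ⟩
    A i p * (A p j * A i j)            ≡⟨ x∙yz≈z∙xy (A i p) (A p j) (A i j) ⟩
    A i j * (A i p * A p j)            ∎

  walk-j-q-i : ∀ q → walk j q i ≡ A i j * (A i q * A q j)
  walk-j-q-i q = begin
    A i j * (A j q * (A q i * A i j))  ≡⟨ cong₂ (λ s t → A i j * (s * (t * A i j))) (adjMatrix-sym G j q) (adjMatrix-sym G q i) ⟩
    A i j * (A q j * (A i q * A i j))  ≡⟨ cong (A i j *_) (x∙yz≈z∙yx (A q j) (A i q) (A i j)) ⟩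
    A i j * (A i j * (A i q * A q j))  ≡⟨ adjMatrix-absorb G i j (A i q * A q j) ⟩
    A i j * (A i q * A q j)            ∎

  walk-j-i-r : ∀ r → walk j i r ≡ A i j * (A i r * A r j)
  walk-j-i-r r = begin
    A i j * (A j i * (A i r * A r j))  ≡⟨ cong (λ t → A i j * (t * (A i r * A r j))) (adjMatrix-sym G j i) ⟩
    A i j * (A i j * (A i r * A r j))  ≡⟨ adjMatrix-absorb G i j (A i r * A r j) ⟩
    A i j * (A i r * A r j)            ∎

  walk-p-i-p : ∀ p → walk p i p ≡ A i p * A p j
  walk-p-i-p p = begin
    A i p * (A p i * (A i p * A p j))  ≡⟨ cong (λ t → A i p * (t * (A i p * A p j))) (adjMatrix-sym G p i) ⟩
    A i p * (A i p * (A i p * A p j))  ≡⟨ cong (A i p *_) (adjMatrix-absorb G i p (A p j)) ⟩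
    A i p * (A i p * A p j)            ≡⟨ adjMatrix-absorb G i p (A p j) ⟩
    A i p * A p j                      ∎

  walk-p-j-p : ∀ p → walk p j p ≡ A i p * A p j
  walk-p-j-p p = begin
    A i p * (A p j * (A j p * A p j))  ≡⟨ cong (λ t → A i p * (A p j * (t * A p j))) (adjMatrix-sym G j p) ⟩
    A i p * (A p j * (A p j * A p j))  ≡⟨ cong (A i p *_) (adjMatrix-absorb G p j (A p j)) ⟩
    A i p * (A p j * A p j)            ≡⟨ cong (A i p *_) (adjMatrix-idem G p j) ⟩
    A i p * A p j                      ∎

  walkSum-* : ∀ (c d : Fin N → Fin N → Fin N → ℤ) →
              walkSum (λ p q r → c p q r * d p q r) ≡ Σ³ (λ p q r → walk p q r * c p q r * d p q r)
  walkSum-* c d = Σ³-cong (λ p q r → sym (*-assoc (walk p q r) (c p q r) (d p q r)))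

  triangles : sumℤ (λ k → A i j * (A i k * A k j)) ≡ (A ∘ₕ A²) i j
  triangles = sym (*-distribˡ-sumℤ (A i j) (λ k → A i k * A k j))

  walks-q=j-r=i : walkSum (λ _ q r → idM q j * idM r i) ≡ (A ∘ₕ A²) i j
  walks-q=j-r=i = begin
    walkSum (λ _ q r → idM q j * idM r i)          ≡⟨ walkSum-* (λ _ q _ → idM q j) (λ _ _ r → idM r i) ⟩
    Σ³ (λ p q r → walk p q r * idM q j * idM r i)  ≡⟨ Σ³-sift₃ (λ p q r → walk p q r * idM q j) (λ _ _ → i) ⟩
    Σ² (λ p q → walk p q i * idM q j)              ≡⟨ Σ²-sift-inner (λ p q → walk p q i) (λ _ → j) ⟩
    sumℤ (λ p → walk p j i)                        ≡⟨ sumℤ-cong walk-p-j-i ⟩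
    sumℤ (λ p → A i j * (A i p * A p j))           ≡⟨ triangles ⟩
    (A ∘ₕ A²) i j                                  ∎

  walks-p=j-r=i : walkSum (λ p _ r → idM p j * idM r i) ≡ (A ∘ₕ A²) i j
  walks-p=j-r=i = begin
    walkSum (λ p _ r → idM p j * idM r i)          ≡⟨ walkSum-* (λ p _ _ → idM p j) (λ _ _ r → idM r i) ⟩
    Σ³ (λ p q r → walk p q r * idM p j * idM r i)  ≡⟨ Σ³-sift₃ (λ p q r → walk p q r * idM p j) (λ _ _ → i) ⟩
    Σ² (λ p q → walk p q i * idM p j)              ≡⟨ Σ²-sift-outer (λ p q → walk p q i) j ⟩
    sumℤ (λ q → walk j q i)                        ≡⟨ sumℤ-cong walk-j-q-i ⟩
    sumℤ (λ q → A i j * (A i q * A q j))           ≡⟨ triangles ⟩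
    (A ∘ₕ A²) i j                                  ∎

  walks-p=j-q=i : walkSum (λ p q _ → idM p j * idM q i) ≡ (A ∘ₕ A²) i j
  walks-p=j-q=i = begin
    walkSum (λ p q _ → idM p j * idM q i)          ≡⟨ walkSum-* (λ p _ _ → idM p j) (λ _ q _ → idM q i) ⟩
    Σ³ (λ p q r → walk p q r * idM p j * idM q i)  ≡⟨ Σ³-sift₂ (λ p q r → walk p q r * idM p j) i ⟩
    Σ² (λ p r → walk p i r * idM p j)              ≡⟨ Σ²-sift-outer (λ p r → walk p i r) j ⟩
    sumℤ (λ r → walk j i r)                        ≡⟨ sumℤ-cong walk-j-i-r ⟩
    sumℤ (λ r → A i j * (A i r * A r j))           ≡⟨ triangles ⟩
    (A ∘ₕ A²) i j                                  ∎

  walks-q=i-r=p : walkSum (λ p q r → idM q i * idM r p) ≡ A² i j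
  walks-q=i-r=p = begin
    walkSum (λ p q r → idM q i * idM r p)          ≡⟨ walkSum-* (λ _ q _ → idM q i) (λ p _ r → idM r p) ⟩
    Σ³ (λ p q r → walk p q r * idM q i * idM r p)  ≡⟨ Σ³-sift₃ (λ p q r → walk p q r * idM q i) (λ p _ → p) ⟩
    Σ² (λ p q → walk p q p * idM q i)              ≡⟨ Σ²-sift-inner (λ p q → walk p q p) (λ _ → i) ⟩
    sumℤ (λ p → walk p i p)                        ≡⟨ sumℤ-cong walk-p-i-p ⟩
    A² i j                                         ∎

  walks-q=j-r=p : walkSum (λ p q r → idM q j * idM r p) ≡ A² i j
  walks-q=j-r=p = begin
    walkSum (λ p q r → idM q j * idM r p)          ≡⟨ walkSum-* (λ _ q _ → idM q j) (λ p _ r → idM r p) ⟩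
    Σ³ (λ p q r → walk p q r * idM q j * idM r p)  ≡⟨ Σ³-sift₃ (λ p q r → walk p q r * idM q j) (λ p _ → p) ⟩
    Σ² (λ p q → walk p q p * idM q j)              ≡⟨ Σ²-sift-inner (λ p q → walk p q p) (λ _ → j) ⟩
    sumℤ (λ p → walk p j p)                        ≡⟨ sumℤ-cong walk-p-j-p ⟩
    A² i j                                         ∎

  isWalk : Fin N → Fin N → Fin N → Bool
  isWalk p q r = adj i p ∧ adj p q ∧ adj q r ∧ adj r j

  χ-isWalk : ∀ p q r → χ (isWalk p q r) ≡ walk p q r
  χ-isWalk p q r = begin
    χ (isWalk p q r)                              ≡⟨ χ-∧ (adj i p) (adj p q ∧ adj q r ∧ adj r j) ⟩
    A i p * χ (adj p q ∧ adj q r ∧ adj r j)       ≡⟨ cong (A i p *_) (χ-∧ (adj p q) (adj q r ∧ adj r j)) ⟩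
    A i p * (A p q * χ (adj q r ∧ adj r j))       ≡⟨ cong (λ t → A i p * (A p q * t)) (χ-∧ (adj q r) (adj r j)) ⟩
    walk p q r                                    ∎

  weight : Fin N → Fin N → Fin N → ℤ
  weight p q r = formulaWeight (idM q i) (idM r i) (idM i j) (idM r p) (idM p j) (idM q j)

  weight-sym : ∀ p q r → formulaWeight (idM i q) (idM i r) (idM i j) (idM p r) (idM p j) (idM q j) ≡ weight p q r
  weight-sym p q r rewrite idM-sym i q | idM-sym i r | idM-sym p r = refl

  walkPattern : ∀ {p q r} → T (isWalk p q r) →
                WalkPattern ⌊ i ≟ p ⌋ ⌊ i ≟ q ⌋ ⌊ i ≟ r ⌋ ⌊ i ≟ j ⌋ ⌊ p ≟ q ⌋
                            ⌊ p ≟ r ⌋ ⌊ p ≟ j ⌋ ⌊ q ≟ r ⌋ ⌊ q ≟ j ⌋ ⌊ r ≟ j ⌋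
  walkPattern w with T-∧⁴ w
  ... | ip , pq , qr , rj =
      fromWitnessFalse (adj⇒≢ G ip) , fromWitnessFalse (adj⇒≢ G pq)
    , fromWitnessFalse (adj⇒≢ G qr) , fromWitnessFalse (adj⇒≢ G rj)
    , (λ iq ir → fromWitness (trans (sym (toWitness iq)) (toWitness ir)))
    , (λ ir ij → fromWitness (trans (sym (toWitness ir)) (toWitness ij)))
    , (λ ir pr → fromWitness (trans (toWitness ir) (sym (toWitness pr))))
    , (λ ij pj → fromWitness (trans (toWitness ij) (sym (toWitness pj))))
    , (λ pr pj → fromWitness (trans (sym (toWitness pr)) (toWitness pj)))
    , (λ pj qj → fromWitness (trans (toWitness pj) (sym (toWitness qj))))
    , (λ iq ij → fromWitness (trans (sym (toWitness iq)) (toWitness ij)))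
    , (λ iq qj → fromWitness (trans (toWitness iq) (toWitness qj)))
    , (λ ij qj → fromWitness (trans (toWitness ij) (sym (toWitness qj))))

  pathIndicator : ∀ p q r → + (if isPath4 G i p q r j then 1 else 0) ≡ walk p q r * weight p q r
  pathIndicator p q r = begin
    + (if isPath4 G i p q r j then 1 else 0)  ≡⟨ pos-if (isPath4 G i p q r j) ⟩
    χ (isPath4 G i p q r j)                   ≡⟨ χ-guarded (isWalk p q r) _ distinct ⟩
    χ (isWalk p q r) * weight p q r           ≡⟨ cong (_* weight p q r) (χ-isWalk p q r) ⟩
    walk p q r * weight p q r                 ∎
    where
    distinct : T (isWalk p q r) →
               χ (i ≢ᵇ p ∧ i ≢ᵇ q ∧ i ≢ᵇ r ∧ i ≢ᵇ j ∧ p ≢ᵇ q ∧ p ≢ᵇ r ∧ p ≢ᵇ j ∧ q ≢ᵇ r ∧ q ≢ᵇ j ∧ r ≢ᵇ j)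
                 ≡ weight p q r
    distinct w = trans (distinctnessWeight _ _ _ _ _ _ _ _ _ _ (walkPattern w)) (weight-sym p q r)

  P4≡walkSum : P4 G i j ≡ walkSum weight
  P4≡walkSum = begin
    P4 G i j
      ≡⟨ trans (pos-sumℕ (λ p → sumℕ λ q → sumℕ (paths p q)))
               (sumℤ-cong λ p → trans (pos-sumℕ (λ q → sumℕ (paths p q))) (sumℤ-cong λ q → pos-sumℕ (paths p q))) ⟩
    Σ³ (λ p q r → + (if isPath4 G i p q r j then 1 else 0))
      ≡⟨ Σ³-cong pathIndicator ⟩
    walkSum weight ∎
    where
    paths : Fin N → Fin N → Fin N → ℕ
    paths p q r = if isPath4 G i p q r j then 1 else 0

mainTheorem4 : ∀ {N} (G : SimpleGraph N) →
  let A = adjMatrix G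
      I = idM
      A² = A ⊗ A
      A³ = A² ⊗ A
      A⁴ = A³ ⊗ A
      D₂ = I ∘ₕ A²
      D₃ = I ∘ₕ A³
  in ∀ i j → P4 G i j ≡
     ( A⁴ ⊖ D₂ ⊗ A² ⊖ D₃ ⊗ A ⊖ I ∘ₕ A⁴ ⊖ A ⊗ D₂ ⊗ A ⊖ A ⊗ D₃ ⊖ A² ⊗ D₂
       ⊕ (+ 3) · (D₂ ⊗ D₂) ⊕ (+ 3) · (A ∘ₕ A²) ⊕ I ∘ₕ (A ⊗ D₂ ⊗ A) ⊕ (+ 2) · A²
       ⊖ (+ 3) · D₂ ⊖ D₂ ⊗ D₂ ⊕ D₂ ) i j
mainTheorem4 G i j = trans P4≡walkSum
  ( walks ⟨-⟩ walks-q=i ⟨-⟩ walks-r=i ⟨-⟩ walks-i=j ⟨-⟩ walks-r=p ⟨-⟩ walks-p=j ⟨-⟩ walks-q=j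
  ⟨+⟩ (+ 3) ⟨*⟩ walks-q=i=j ⟨+⟩ thrice walks-q=j-r=i walks-p=j-r=i walks-p=j-q=i
  ⟨+⟩ idM i j ⟨*⟩ walks-r=p ⟨+⟩ twice walks-q=i-r=p walks-q=j-r=p
  ⟨-⟩ (+ 3) ⟨*⟩ idM i j ⟨*⟩ walks-q=i-r=p ⟨-⟩ walks-q=i=j ⟨+⟩ idM i j ⟨*⟩ walks-q=i-r=p )
  where open Walks G i j
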